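{- Let $t$ be a positive integer, $\mu$ a partition and $g$ a function on partitions. For $n\in\mathbb N$ let $$P_g(n)=\sum_{\substack{\lambda\ge_t\mu\\ |\lambda|-|\mu|=nt}}F_{\lambda/\mu}\,g(\lambda).$$ Then $P_g(n+1)-P_g(n)=P_{D_tg}(n)$ for all $n\in\mathbb N$.
   Context: The 01-sequence $(z_i)_{i\in\mathbb Z}$ of a partition: traverse the boundary of its Young diagram from the bottom (infinite vertical ray below the first column) to the right (infinite horizontal ray right of the first row), labelling vertical edges $0$ and horizontal edges $1$, indexed so that $\#\{i\ge0:z_i=0\}=\#\{i<0:z_i=1\}$. Adding a $t$-hook means exchanging some $z_i=0,z_{i+t}=1$ into $1,0$. $\lambda\ge_t\mu$ means $\lambda$ is obtained from $\mu$ by adding a (possibly empty) sequence of $t$-hooks. $F_{\lambda/\mu}$ (for $\lambda\ge_t\mu$): $F_{\mu/\mu}=1$ and $F_{\lambda/\mu}=\sum F_{\lambda^-/\mu}$ over all $\lambda^-$ with $\lambda\ge_t\lambda^-\ge_t\mu$ and $|\lambda|-|\lambda^-|=t$. For a function $g$ on partitions, $D_tg(\lambda)=\sum_{\lambda^+}g(\lambda^+)-g(\lambda)$, the sum over all partitions $\lambda^+$ obtained from $\lambda$ by adding one $t$-hook. -}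

module Defs where

open import Level using (Level)
open import Data.Bool using (Bool; true; false; not; _∧_; if_then_else_)
open import Data.Nat using (ℕ; zero; suc; _+_; _*_; _∸_; _≤_; _<_; _≥_; _⊔_)
import Data.Nat as ℕ
open import Data.Integer using (ℤ; +_; -[1+_])
import Data.Integer as ℤ
open import Data.List using (List; []; _∷_; _++_; map; concatMap; length; replicate; upTo; foldr)
open import Data.Bool.ListAction using (any; all)
open import Data.Nat.ListAction using (sum)
open import Data.List.Relation.Unary.All using (All)
open import Data.List.Relation.Unary.Linked using (Linked)
open import Data.Product using (_×_)
open import Relation.Nullary.Decidable using (⌊_⌋)
open import Algebra.Bundles using (CommutativeRing)
import Algebra.Definitions.RawMonoid as RM

IsPartition : List ℕ → Set
IsPartition λ′ = Linked _≥_ λ′ × All (0 <_) λ′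

∣_∣ₚ : List ℕ → ℕ
∣ λ′ ∣ₚ = sum λ′

_==ᴸ_ : List ℕ → List ℕ → Bool
[] ==ᴸ [] = true
(a ∷ as) ==ᴸ (b ∷ bs) = ⌊ a ℕ.≟ b ⌋ ∧ (as ==ᴸ bs)
_ ==ᴸ _ = false

_==ℕ_ : ℕ → ℕ → Bool
a ==ℕ b = ⌊ a ℕ.≟ b ⌋

-- enumeration of all partitions of n (as decreasing positive lists)
-- partsB f n k : partitions of n with all parts ≤ k (fuel f ≥ n)
private
  range1 : ℕ → List ℕ
  range1 m = map suc (upTo m)

partsB : ℕ → ℕ → ℕ → List (List ℕ)
partsB _       zero    k = [] ∷ []
partsB zero    (suc n) k = []
partsB (suc f) (suc n) k =
  concatMap (λ p → map (p ∷_) (partsB f (suc n ∸ p) p)) (range1 (suc n ℕ.⊓ k))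

partitions : ℕ → List (List ℕ)
partitions n = partsB n n n

-- The 01-sequence.  false = 0 (vertical edge), true = 1 (horizontal edge).
-- The finite part of the boundary of λ = (λ₁ ≥ … ≥ λₗ > 0), read from the
-- bottom (after the infinite vertical ray) to the top row:
--   1^{λₗ} 0 1^{λₗ₋₁-λₗ} 0 … 1^{λ₁-λ₂} 0

private
  headOr0 : List ℕ → ℕ
  headOr0 [] = 0
  headOr0 (a ∷ _) = a

boundaryWord : List ℕ → List Bool
boundaryWord [] = []
boundaryWord (a ∷ rest) = boundaryWord rest ++ (replicate (a ∸ headOr0 rest) true ++ false ∷ [])

private
  nthOr : Bool → List Bool → ℕ → Bool
  nthOr d [] _ = d
  nthOr d (x ∷ xs) zero = x
  nthOr d (x ∷ xs) (suc n) = nthOr d xs n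

  seqAt : List Bool → ℤ → Bool
  seqAt w -[1+ _ ] = false
  seqAt w (+ n) = nthOr true w n

-- z λ i : the i-th letter of the 01-sequence of λ.  The finite word is
-- placed at indices -ℓ(λ), …, λ₁-1, which is the indexing for which
-- #{i ≥ 0 : zᵢ = 0} = #{i < 0 : zᵢ = 1}.
z : List ℕ → ℤ → Bool
z λ′ i = seqAt (boundaryWord λ′) (i ℤ.+ + length λ′)

private
  _==ᴮ_ : Bool → Bool → Bool
  true  ==ᴮ b = b
  false ==ᴮ b = not b

  _==ℤ_ : ℤ → ℤ → Bool
  a ==ℤ b = ⌊ a ℤ.≟ b ⌋

  intRange : ℕ → List ℤ
  intRange M = map (λ k → + k ℤ.- + M) (upTo (M + M))

swapped : List ℕ → ℕ → ℤ → ℤ → Bool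
swapped λ′ t i k =
  if k ==ℤ i then true
  else if k ==ℤ (i ℤ.+ + t) then false
  else z λ′ k

-- The quantifiers over ℤ are bounded by ranges that
-- contain every relevant index (outside of them both sequences are
-- constant: 0 below -ℓ, 1 from the largest part on).
addHook : ℕ → List ℕ → List ℕ → Bool
addHook t λ′ λ⁺ =
  any (λ i → not (z λ′ i) ∧ z λ′ (i ℤ.+ + t)
               ∧ all (λ k → z λ⁺ k ==ᴮ swapped λ′ t i k) (intRange M))
      (intRange N)
  where
  N = length λ′ + ∣ λ′ ∣ₚ + t
  M = length λ′ + length λ⁺ + ∣ λ′ ∣ₚ + ∣ λ⁺ ∣ₚ + t

filterᴮ : {A : Set} → (A → Bool) → List A → List A
filterᴮ p [] = []
filterᴮ p (x ∷ xs) = if p x then x ∷ filterᴮ p xs else filterᴮ p xs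

reach : ℕ → List ℕ → ℕ → List ℕ → Bool
reach t μ zero λ′ = λ′ ==ᴸ μ
reach t μ (suc n) λ′ =
  any (λ ν → reach t μ n ν ∧ addHook t ν λ′) (partitions (∣ μ ∣ₚ + n * t))

-- λ ≥ₜ μ : λ is obtained from μ by adding a (possibly empty) sequence of
-- t-hooks (the number n of hooks is at most |λ| since t ≥ 1)
geqₜ : ℕ → List ℕ → List ℕ → Bool
geqₜ t λ′ μ =
  any (λ n → (∣ λ′ ∣ₚ ==ℕ (∣ μ ∣ₚ + n * t)) ∧ reach t μ n λ′) (upTo (suc ∣ λ′ ∣ₚ))

-- F_{λ/μ} : F_{μ/μ} = 1, and otherwise the sum of F_{λ⁻/μ} over
-- λ ≥ₜ λ⁻ ≥ₜ μ with |λ| - |λ⁻| = t.  Recursion with fuel (fuel |λ| suffices).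
Fuel : ℕ → List ℕ → ℕ → List ℕ → ℕ
Fuel t μ f λ′ with λ′ ==ᴸ μ
... | true = 1
Fuel t μ zero λ′ | false = 0
Fuel t μ (suc f) λ′ | false =
  sum (map (Fuel t μ f)
           (filterᴮ (λ ν → geqₜ t λ′ ν ∧ geqₜ t ν μ)
                    (partitions (∣ λ′ ∣ₚ ∸ t))))

F : ℕ → List ℕ → List ℕ → ℕ
F t μ λ′ = Fuel t μ ∣ λ′ ∣ₚ λ′

module _ {c ℓ : Level} (R : CommutativeRing c ℓ) where
  open CommutativeRing R using (Carrier; 0#; +-rawMonoid) renaming (_+_ to _+ᴿ_; _-_ to _-ᴿ_)
  open RM +-rawMonoid using () renaming (_×_ to _·_)

  Σᴿ : List Carrier → Carrier
  Σᴿ = foldr _+ᴿ_ 0#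

  -- D_t g (λ) = Σ_{λ⁺} g(λ⁺) - g(λ), λ⁺ ranging over partitions obtained
  -- from λ by adding one t-hook (all of them have size |λ| + t)
  Dₜ : ℕ → (List ℕ → Carrier) → List ℕ → Carrier
  Dₜ t g λ′ = Σᴿ (map g (filterᴮ (addHook t λ′) (partitions (∣ λ′ ∣ₚ + t)))) -ᴿ g λ′

  P : ℕ → List ℕ → (List ℕ → Carrier) → ℕ → Carrier
  P t μ g n = Σᴿ (map (λ λ′ → F t μ λ′ · g λ′)
                      (filterᴮ (λ λ′ → geqₜ t λ′ μ) (partitions (∣ μ ∣ₚ + n * t))))

-- By the recursion for F, each F_{λ/μ} with |λ| = |μ| + (n+1)t is the sum of the F_{ν/μ} over the
-- ν ≥ₜ μ one level lower with λ ≥ₜ ν, and between consecutive levels λ ≥ₜ ν just says that λ arises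
-- from ν by adding one t-hook.  Exchanging the order of summation therefore turns P_g(n+1) into
-- Σ_ν F_{ν/μ} Σ_{ν⁺} g(ν⁺), which is P_{D_t g}(n) + P_g(n) by the definition of D_t.

module Submission where

open import Defs
open import Level using (Level)
open import Data.Bool using (Bool; true; false; T; _∧_; if_then_else_)
open import Data.Bool.Properties using (T-∧; T-≡)
open import Data.Bool.ListAction using (any)
open import Data.Nat using (ℕ; zero; suc; pred; s≤s; s≤s⁻¹; _+_; _*_; _∸_; _≤_; _<_; _⊓_; NonZero; ≢-nonZero; >-nonZero; >-nonZero⁻¹)
open import Data.Nat.Properties
  using ( +-comm; +-assoc; +-identityʳ; *-identityˡ; +-cancelˡ-≡; *-cancelʳ-≡; m*n≡0⇒m≡0; m+n≡0⇒n≡0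
        ; ≤-trans; ≤-reflexive; <-irrefl; ≤-<-trans; <-≤-trans; n≤0⇒n≡0; m≤n⇒m<n∨m≡n; m<n⇒n≢0
        ; m≤m+n; m≤n+m; m<m+n; m≤m*n; m⊓n≤m; m+[n∸m]≡n; m+n∸n≡m; ∸-monoʳ-≤
        ; pred-mono-≤; suc-pred; pred[m∸n]≡m∸[1+n]; +-0-commutativeMonoid; module ≤-Reasoning)
open import Data.Nat.ListAction using (sum)
open import Data.List using (List; []; _∷_; map; foldr; upTo)
open import Data.List.Relation.Unary.Any using (here; there)
open import Data.List.Relation.Unary.Any.Properties using (any⁺; any⁻)
open import Data.List.Membership.Propositional using (_∈_; find; lose)
open import Data.List.Membership.Propositional.Properties
  using (∈-concatMap⁻; ∈-map⁻; ∈-upTo⁺; ∈-upTo⁻)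
open import Data.Product using (_×_; _,_; ∃; proj₁; proj₂)
open import Data.Sum using (inj₁; inj₂)
open import Data.Empty using (⊥-elim)
open import Function using (_∘_; Equivalence; _⇔_; mk⇔)
open import Relation.Nullary.Decidable using (toWitness; fromWitness)
open import Relation.Binary.PropositionalEquality as ≡
  using (_≡_; _≢_; refl; cong; cong₂; subst; module ≡-Reasoning)
open import Algebra.Bundles using (CommutativeMonoid; CommutativeRing)

T-ext : ∀ {x y} → (T x → T y) → (T y → T x) → x ≡ y
T-ext {false} {false} _ _ = refl
T-ext {false} {true}  _ y⇒x = ⊥-elim (y⇒x _)
T-ext {true}  {false} x⇒y _ = ⊥-elim (x⇒y _)
T-ext {true}  {true}  _ _ = refl

module _ {A : Set} (p : A → Bool) where

  any-∈⁺ : ∀ {x xs} → x ∈ xs → T (p x) → T (any p xs)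
  any-∈⁺ x∈xs px = any⁺ p (lose x∈xs px)

  any-∈⁻ : ∀ xs → T (any p xs) → ∃ λ x → x ∈ xs × T (p x)
  any-∈⁻ xs = find ∘ any⁻ p xs

  ∈-filterᴮ⁻ : ∀ xs {x} → x ∈ filterᴮ p xs → x ∈ xs × T (p x)
  ∈-filterᴮ⁻ (y ∷ xs) x∈ with p y in py
  ∈-filterᴮ⁻ (y ∷ xs) (here refl) | true = here refl , Equivalence.from T-≡ py
  ∈-filterᴮ⁻ (y ∷ xs) (there x∈)  | true = let x∈xs , px = ∈-filterᴮ⁻ xs x∈ in there x∈xs , px
  ∈-filterᴮ⁻ (y ∷ xs) x∈          | false = let x∈xs , px = ∈-filterᴮ⁻ xs x∈ in there x∈xs , px

==ᴸ⇒≡ : ∀ xs ys → T (xs ==ᴸ ys) → xs ≡ ys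
==ᴸ⇒≡ []       []       _ = refl
==ᴸ⇒≡ (x ∷ xs) (y ∷ ys) h =
  let x≡y , xs≡ys = Equivalence.to T-∧ h
  in cong₂ _∷_ (toWitness x≡y) (==ᴸ⇒≡ xs ys xs≡ys)

==ᴸ-refl : ∀ xs → T (xs ==ᴸ xs)
==ᴸ-refl []       = _
==ᴸ-refl (x ∷ xs) = Equivalence.from T-∧ (fromWitness refl , ==ᴸ-refl xs)

∣∣-∈-partsB : ∀ f m k {ν} → ν ∈ partsB f m k → ∣ ν ∣ₚ ≡ m
∣∣-∈-partsB f zero k (here refl) = refl
∣∣-∈-partsB (suc f) (suc m) k ν∈
  with p , p∈ , ν∈′ ← find (∈-concatMap⁻ (λ p → map (p ∷_) (partsB f (suc m ∸ p) p))
                  {xs = map suc (upTo (suc m ⊓ k))} ν∈)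
  with ν′ , ν′∈ , refl ← ∈-map⁻ (p ∷_) ν∈′
  with i , i∈ , refl ← ∈-map⁻ suc p∈ =
  begin
    suc i + ∣ ν′ ∣ₚ      ≡⟨ cong (suc i +_) (∣∣-∈-partsB f (suc m ∸ suc i) (suc i) ν′∈) ⟩
    suc i + (m ∸ i)      ≡⟨ m+[n∸m]≡n (≤-trans (∈-upTo⁻ i∈) (m⊓n≤m (suc m) k)) ⟩
    suc m                ∎
  where open ≡-Reasoning

∣∣-∈-partitions : ∀ m {ν} → ν ∈ partitions m → ∣ ν ∣ₚ ≡ m
∣∣-∈-partitions m = ∣∣-∈-partsB m m m

module ListSum {c ℓ : Level} (M : CommutativeMonoid c ℓ) where

  open CommutativeMonoid M renaming (refl to ≈-refl)
  open import Algebra.Properties.CommutativeSemigroup commutativeSemigroup using (interchange)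
  open import Algebra.Properties.CommutativeMonoid.Mult M public
    using () renaming (_×_ to _·_; ×-congʳ to ·-congʳ; ×-homo-+ to ·-homo-+; ×-distrib-+ to ·-distrib-∙)
  open import Relation.Binary.Reasoning.Setoid setoid

  ∑ : {A : Set} → List A → (A → Carrier) → Carrier
  ∑ xs f = foldr _∙_ ε (map f xs)

  when : Bool → Carrier → Carrier
  when b x = if b then x else ε

  module _ {A : Set} where

    ∑-cong : ∀ xs {f g : A → Carrier} → (∀ {x} → x ∈ xs → f x ≈ g x) → ∑ xs f ≈ ∑ xs g
    ∑-cong []       f≈g = ≈-refl
    ∑-cong (x ∷ xs) f≈g = ∙-cong (f≈g (here refl)) (∑-cong xs (f≈g ∘ there))

    ∑-0 : ∀ (xs : List A) → ∑ xs (λ _ → ε) ≈ ε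
    ∑-0 []       = ≈-refl
    ∑-0 (x ∷ xs) = trans (identityˡ _) (∑-0 xs)

    ∑-+ : ∀ xs (f g : A → Carrier) → ∑ xs (λ x → f x ∙ g x) ≈ ∑ xs f ∙ ∑ xs g
    ∑-+ []       f g = sym (identityˡ ε)
    ∑-+ (x ∷ xs) f g = trans (∙-congˡ (∑-+ xs f g)) (interchange _ _ _ _)

    when-∑ : ∀ b xs (f : A → Carrier) → when b (∑ xs f) ≈ ∑ xs (when b ∘ f)
    when-∑ true  xs f = ≈-refl
    when-∑ false xs f = sym (∑-0 xs)

    ∑-filterᴮ : ∀ (p : A → Bool) xs f → ∑ (filterᴮ p xs) f ≈ ∑ xs (λ x → when (p x) (f x))
    ∑-filterᴮ p []       f = ≈-refl
    ∑-filterᴮ p (x ∷ xs) f with p x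
    ... | true  = ∙-congˡ (∑-filterᴮ p xs f)
    ... | false = trans (∑-filterᴮ p xs f) (sym (identityˡ _))

    ·-∑ : ∀ n xs (f : A → Carrier) → n · ∑ xs f ≈ ∑ xs (λ x → n · f x)
    ·-∑ n []       f = ·-ε n
      where
      ·-ε : ∀ n → n · ε ≈ ε
      ·-ε zero    = ≈-refl
      ·-ε (suc n) = trans (identityˡ _) (·-ε n)
    ·-∑ n (x ∷ xs) f = trans (·-distrib-∙ _ _ n) (∙-congˡ (·-∑ n xs f))

    sum-· : ∀ xs (h : A → ℕ) y → sum (map h xs) · y ≈ ∑ xs (λ x → h x · y)
    sum-· []       h y = ≈-refl
    sum-· (x ∷ xs) h y = trans (·-homo-+ y (h x) _) (∙-congˡ (sum-· xs h y))

  ∑-comm : ∀ {A B : Set} (xs : List A) (ys : List B) (f : A → B → Carrier) →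
           ∑ xs (λ x → ∑ ys (f x)) ≈ ∑ ys (λ y → ∑ xs (λ x → f x y))
  ∑-comm []       ys f = sym (∑-0 ys)
  ∑-comm (x ∷ xs) ys f = begin
    ∑ ys (f x) ∙ ∑ xs (λ x → ∑ ys (f x))           ≈⟨ ∙-congˡ (∑-comm xs ys f) ⟩
    ∑ ys (f x) ∙ ∑ ys (λ y → ∑ xs (λ x → f x y))   ≈⟨ ∑-+ ys (f x) _ ⟨
    ∑ ys (λ y → f x y ∙ ∑ xs (λ x → f x y))        ∎

  module _ {A B : Set} (p : A → Bool) (q : A → B → Bool) (xs : List A) (ys : List B) (f : A → B → Carrier) where

    ∑-filterᴮ² : ∑ (filterᴮ p xs) (λ x → ∑ (filterᴮ (q x) ys) (f x))
               ≈ ∑ xs (λ x → ∑ ys (λ y → when (p x ∧ q x y) (f x y)))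
    ∑-filterᴮ² = begin
      ∑ (filterᴮ p xs) (λ x → ∑ (filterᴮ (q x) ys) (f x))
        ≈⟨ ∑-filterᴮ p xs _ ⟩
      ∑ xs (λ x → when (p x) (∑ (filterᴮ (q x) ys) (f x)))
        ≈⟨ ∑-cong xs (λ {x} _ → when-cong (p x) (∑-filterᴮ (q x) ys (f x))) ⟩
      ∑ xs (λ x → when (p x) (∑ ys (λ y → when (q x y) (f x y))))
        ≈⟨ ∑-cong xs (λ {x} _ → when-∑ (p x) ys _) ⟩
      ∑ xs (λ x → ∑ ys (λ y → when (p x) (when (q x y) (f x y))))
        ≈⟨ ∑-cong xs (λ {x} _ → ∑-cong ys (λ {y} _ → when-∧ (p x) (q x y) (f x y))) ⟩
      ∑ xs (λ x → ∑ ys (λ y → when (p x ∧ q x y) (f x y)))   ∎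
      where
      when-cong : ∀ b {u v} → u ≈ v → when b u ≈ when b v
      when-cong true  u≈v = u≈v
      when-cong false _   = ≈-refl
      when-∧ : ∀ a b u → when a (when b u) ≈ when (a ∧ b) u
      when-∧ true  b u = ≈-refl
      when-∧ false b u = ≈-refl

  ∑-filterᴮ-comm : ∀ {A B : Set} (p : A → Bool) (q : A → B → Bool) (p′ : B → Bool) (q′ : B → A → Bool)
    (xs : List A) (ys : List B) (f : A → B → Carrier) →
    (∀ {x y} → x ∈ xs → y ∈ ys → p x ∧ q x y ≡ p′ y ∧ q′ y x) →
    ∑ (filterᴮ p xs) (λ x → ∑ (filterᴮ (q x) ys) (f x))
      ≈ ∑ (filterᴮ p′ ys) (λ y → ∑ (filterᴮ (q′ y) xs) (λ x → f x y))
  ∑-filterᴮ-comm p q p′ q′ xs ys f same = begin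
    ∑ (filterᴮ p xs) (λ x → ∑ (filterᴮ (q x) ys) (f x))
      ≈⟨ ∑-filterᴮ² p q xs ys f ⟩
    ∑ xs (λ x → ∑ ys (λ y → when (p x ∧ q x y) (f x y)))
      ≈⟨ ∑-comm xs ys _ ⟩
    ∑ ys (λ y → ∑ xs (λ x → when (p x ∧ q x y) (f x y)))
      ≈⟨ ∑-cong ys (λ y∈ → ∑-cong xs (λ x∈ → reflexive (cong (λ b → when b _) (same x∈ y∈)))) ⟩
    ∑ ys (λ y → ∑ xs (λ x → when (p′ y ∧ q′ y x) (f x y)))
      ≈⟨ ∑-filterᴮ² p′ q′ ys xs (λ y x → f x y) ⟨
    ∑ (filterᴮ p′ ys) (λ y → ∑ (filterᴮ (q′ y) xs) (λ x → f x y))   ∎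

module Hooks (t : ℕ) .{{_ : NonZero t}} where

  hook-count-unique : ∀ k m m′ → k + m * t ≡ k + m′ * t → m ≡ m′
  hook-count-unique k m m′ eq = *-cancelʳ-≡ m m′ t (+-cancelˡ-≡ k _ _ eq)

  geqₜ⇒reach : ∀ ν ρ → T (geqₜ t ν ρ) → ∃ λ m → ∣ ν ∣ₚ ≡ ∣ ρ ∣ₚ + m * t × T (reach t ρ m ν)
  geqₜ⇒reach ν ρ h =
    let m , _ , size×reach = any-∈⁻ _ (upTo (suc ∣ ν ∣ₚ)) h
        size , r = Equivalence.to T-∧ size×reach
    in m , toWitness size , r

  reach⇒geqₜ : ∀ ν ρ m → ∣ ν ∣ₚ ≡ ∣ ρ ∣ₚ + m * t → T (reach t ρ m ν) → T (geqₜ t ν ρ)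
  reach⇒geqₜ ν ρ m size r =
    any-∈⁺ _ (∈-upTo⁺ (s≤s m≤∣ν∣)) (Equivalence.from T-∧ (fromWitness size , r))
    where
    m≤∣ν∣ : m ≤ ∣ ν ∣ₚ
    m≤∣ν∣ = ≤-trans (m≤m*n m t) (≤-trans (m≤n+m (m * t) ∣ ρ ∣ₚ) (≤-reflexive (≡.sym size)))

  reach-suc : ∀ ρ ν ν′ m → ν ∈ partitions (∣ ρ ∣ₚ + m * t) →
              T (reach t ρ m ν) → T (addHook t ν ν′) → T (reach t ρ (suc m) ν′)
  reach-suc ρ ν ν′ m ν∈ r h = any-∈⁺ _ ν∈ (Equivalence.from T-∧ (r , h))

  reach-one⇒addHook : ∀ ρ ν → T (reach t ρ 1 ν) → T (addHook t ρ ν)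
  reach-one⇒addHook ρ ν r =
    let ν′ , _ , eq×h = any-∈⁻ _ (partitions (∣ ρ ∣ₚ + 0)) r
        eq , h = Equivalence.to T-∧ eq×h
    in subst (λ ρ′ → T (addHook t ρ′ ν)) (==ᴸ⇒≡ ν′ ρ eq) h

  geqₜ⇔addHook : ∀ {k} ρ ν → ρ ∈ partitions k → ∣ ν ∣ₚ ≡ k + t →
                 T (geqₜ t ν ρ) ⇔ T (addHook t ρ ν)
  geqₜ⇔addHook {k} ρ ν ρ∈ size = mk⇔ to from
    where
    ∣ρ∣≡k : ∣ ρ ∣ₚ ≡ k
    ∣ρ∣≡k = ∣∣-∈-partitions k ρ∈
    size₁ : ∣ ν ∣ₚ ≡ ∣ ρ ∣ₚ + 1 * t
    size₁ = ≡.trans size (cong₂ _+_ (≡.sym ∣ρ∣≡k) (≡.sym (*-identityˡ t)))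
    to : T (geqₜ t ν ρ) → T (addHook t ρ ν)
    to g with m , size′ , r ← geqₜ⇒reach ν ρ g
         with refl ← hook-count-unique ∣ ρ ∣ₚ m 1 (≡.trans (≡.sym size′) size₁)
         = reach-one⇒addHook ρ ν r
    from : T (addHook t ρ ν) → T (geqₜ t ν ρ)
    from h = reach⇒geqₜ ν ρ 1 size₁ (reach-suc ρ ρ ν 0 ρ∈₀ (==ᴸ-refl ρ) h)
      where
      ρ∈₀ : ρ ∈ partitions (∣ ρ ∣ₚ + 0)
      ρ∈₀ = subst (λ j → ρ ∈ partitions j) (≡.sym (≡.trans (+-identityʳ _) ∣ρ∣≡k)) ρ∈

  addHook-preserves-geqₜ : ∀ μ ν ν′ m → ν ∈ partitions (∣ μ ∣ₚ + m * t) →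
    ∣ ν′ ∣ₚ ≡ ∣ μ ∣ₚ + suc m * t → T (geqₜ t ν μ) → T (addHook t ν ν′) → T (geqₜ t ν′ μ)
  addHook-preserves-geqₜ μ ν ν′ m ν∈ size′ g h
    with m′ , size , r ← geqₜ⇒reach ν μ g
    with refl ← hook-count-unique ∣ μ ∣ₚ m′ m (≡.trans (≡.sym size) (∣∣-∈-partitions _ ν∈))
    = reach⇒geqₜ ν′ μ (suc m) size′ (reach-suc μ ν ν′ m ν∈ r h)

  module _ (μ : List ℕ) where

    -- sum (map f xs) is definitionally ℕ-∑.∑ xs f.
    private module ℕ-∑ = ListSum +-0-commutativeMonoid

    between : List ℕ → List ℕ → Bool
    between λ′ ν = geqₜ t λ′ ν ∧ geqₜ t ν μ

    predecessors : List ℕ → List (List ℕ)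
    predecessors λ′ = filterᴮ (between λ′) (partitions (∣ λ′ ∣ₚ ∸ t))

    ∈-predecessors⁻ : ∀ λ′ {ν} → ν ∈ predecessors λ′ → ∣ ν ∣ₚ ≡ ∣ λ′ ∣ₚ ∸ t × T (between λ′ ν)
    ∈-predecessors⁻ λ′ ν∈ =
      let ν∈ₚ , b = ∈-filterᴮ⁻ (between λ′) (partitions (∣ λ′ ∣ₚ ∸ t)) ν∈
      in ∣∣-∈-partitions _ ν∈ₚ , b

    ∣∣-∈-predecessors : ∀ λ′ {ν} → ν ∈ predecessors λ′ → ∣ ν ∣ₚ ≤ pred ∣ λ′ ∣ₚ
    ∣∣-∈-predecessors λ′ {ν} ν∈ = begin
      ∣ ν ∣ₚ           ≡⟨ proj₁ (∈-predecessors⁻ λ′ ν∈) ⟩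
      ∣ λ′ ∣ₚ ∸ t      ≤⟨ ∸-monoʳ-≤ ∣ λ′ ∣ₚ (>-nonZero⁻¹ t) ⟩
      ∣ λ′ ∣ₚ ∸ 1      ≡⟨ pred[m∸n]≡m∸[1+n] ∣ λ′ ∣ₚ 0 ⟨
      pred ∣ λ′ ∣ₚ     ∎
      where open ≤-Reasoning

    Fuel-unfold : ∀ f ν → ν ==ᴸ μ ≡ false → Fuel t μ (suc f) ν ≡ sum (map (Fuel t μ f) (predecessors ν))
    Fuel-unfold f ν ν≢μ rewrite ν≢μ = refl

    -- For f = 0 a predecessor of ν equal to μ would force |ν| = |μ|, hence ν = μ.
    Fuel-suc : ∀ f ν → ∣ ν ∣ₚ ≤ f → Fuel t μ (suc f) ν ≡ Fuel t μ f ν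
    Fuel-suc f ν ∣ν∣≤f with ν ==ᴸ μ in ν≢μ
    ... | true = refl
    Fuel-suc zero ν ∣ν∣≤0 | false =
      ≡.trans (ℕ-∑.∑-cong (predecessors ν) λ x∈ → Fuel-zero (proj₂ (∈-predecessors⁻ ν x∈)))
              (ℕ-∑.∑-0 (predecessors ν))
      where
      Fuel-zero : ∀ {x} → T (between ν x) → Fuel t μ 0 x ≡ 0
      Fuel-zero {x} b with x ==ᴸ μ in x≡μ
      ... | false = refl
      ... | true with refl ← ==ᴸ⇒≡ x μ (Equivalence.from T-≡ x≡μ)
                 with m , size , r ← geqₜ⇒reach ν μ (proj₁ (Equivalence.to T-∧ b))
                 with refl ← m*n≡0⇒m≡0 m t (m+n≡0⇒n≡0 ∣ μ ∣ₚ (≡.trans (≡.sym size) (n≤0⇒n≡0 ∣ν∣≤0)))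
                 = ⊥-elim (subst T ν≢μ r)
    Fuel-suc (suc f) ν ∣ν∣≤1+f | false =
      ℕ-∑.∑-cong (predecessors ν) λ {x} x∈ →
        Fuel-suc f x (≤-trans (∣∣-∈-predecessors ν x∈) (pred-mono-≤ ∣ν∣≤1+f))

    Fuel≡F : ∀ f ν → ∣ ν ∣ₚ ≤ f → Fuel t μ f ν ≡ F t μ ν
    Fuel≡F f ν ∣ν∣≤f with m≤n⇒m<n∨m≡n ∣ν∣≤f
    ... | inj₂ refl = refl
    Fuel≡F (suc f) ν _ | inj₁ ∣ν∣<1+f =
      ≡.trans (Fuel-suc f ν (s≤s⁻¹ ∣ν∣<1+f)) (Fuel≡F f ν (s≤s⁻¹ ∣ν∣<1+f))

    F-recursion : ∀ λ′ → ∣ μ ∣ₚ < ∣ λ′ ∣ₚ → F t μ λ′ ≡ sum (map (F t μ) (predecessors λ′))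
    F-recursion λ′ μ<λ′ = begin
      Fuel t μ ∣ λ′ ∣ₚ λ′
        ≡⟨ cong (λ k → Fuel t μ k λ′) (≡.sym (suc-pred ∣ λ′ ∣ₚ {{≢-nonZero ∣λ′∣≢0}})) ⟩
      Fuel t μ (suc f) λ′
        ≡⟨ Fuel-unfold f λ′ λ′≢μ ⟩
      sum (map (Fuel t μ f) (predecessors λ′))
        ≡⟨ ℕ-∑.∑-cong (predecessors λ′) (λ {ν} ν∈ → Fuel≡F f ν (∣∣-∈-predecessors λ′ ν∈)) ⟩
      sum (map (F t μ) (predecessors λ′))        ∎
      where
      open ≡-Reasoning
      f : ℕ
      f = pred ∣ λ′ ∣ₚ
      ∣λ′∣≢0 : ∣ λ′ ∣ₚ ≢ 0
      ∣λ′∣≢0 = m<n⇒n≢0 μ<λ′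
      λ′≢μ : λ′ ==ᴸ μ ≡ false
      λ′≢μ with λ′ ==ᴸ μ in λ′≡μ
      ... | false = refl
      ... | true with refl ← ==ᴸ⇒≡ λ′ μ (Equivalence.from T-≡ λ′≡μ) = ⊥-elim (<-irrefl refl μ<λ′)

    level : ℕ → List (List ℕ)
    level m = partitions (∣ μ ∣ₚ + m * t)

    size-level-suc : ∀ m → ∣ μ ∣ₚ + suc m * t ≡ (∣ μ ∣ₚ + m * t) + t
    size-level-suc m = ≡.trans (cong (∣ μ ∣ₚ +_) (+-comm t (m * t))) (≡.sym (+-assoc ∣ μ ∣ₚ (m * t) t))

    partitions-after-hook : ∀ m {ν} → ν ∈ level m → partitions (∣ ν ∣ₚ + t) ≡ level (suc m)
    partitions-after-hook m ν∈ =
      ≡.trans (cong (λ k → partitions (k + t)) (∣∣-∈-partitions (∣ μ ∣ₚ + m * t) ν∈))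
              (cong partitions (≡.sym (size-level-suc m)))

    F-recursion-level : ∀ m {λ′} → λ′ ∈ level (suc m) →
      F t μ λ′ ≡ sum (map (F t μ) (filterᴮ (between λ′) (level m)))
    F-recursion-level m {λ′} λ′∈ =
      ≡.trans (F-recursion λ′ μ<λ′)
              (cong (sum ∘ map (F t μ) ∘ filterᴮ (between λ′) ∘ partitions) ∣λ′∣∸t)
      where
      ∣λ′∣ : ∣ λ′ ∣ₚ ≡ ∣ μ ∣ₚ + m * t + t
      ∣λ′∣ = ≡.trans (∣∣-∈-partitions _ λ′∈) (size-level-suc m)
      μ<λ′ : ∣ μ ∣ₚ < ∣ λ′ ∣ₚ
      μ<λ′ = ≤-<-trans (m≤m+n ∣ μ ∣ₚ (m * t)) (<-≤-trans (m<m+n _ (>-nonZero⁻¹ t)) (≤-reflexive (≡.sym ∣λ′∣)))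
      ∣λ′∣∸t : ∣ λ′ ∣ₚ ∸ t ≡ ∣ μ ∣ₚ + m * t
      ∣λ′∣∸t = ≡.trans (cong (_∸ t) ∣λ′∣) (m+n∸n≡m _ t)

    geqₜ-between≡geqₜ-addHook : ∀ m {λ′ ν} → λ′ ∈ level (suc m) → ν ∈ level m →
      geqₜ t λ′ μ ∧ between λ′ ν ≡ geqₜ t ν μ ∧ addHook t ν λ′
    geqₜ-between≡geqₜ-addHook m {λ′} {ν} λ′∈ ν∈ = T-ext to from
      where
      ∣λ′∣ : ∣ λ′ ∣ₚ ≡ ∣ μ ∣ₚ + suc m * t
      ∣λ′∣ = ∣∣-∈-partitions _ λ′∈
      λ′≥ν⇔hook : T (geqₜ t λ′ ν) ⇔ T (addHook t ν λ′)
      λ′≥ν⇔hook = geqₜ⇔addHook ν λ′ ν∈ (≡.trans ∣λ′∣ (size-level-suc m))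
      to : T (geqₜ t λ′ μ ∧ between λ′ ν) → T (geqₜ t ν μ ∧ addHook t ν λ′)
      to h = let _ , λ′≥ν×ν≥μ = Equivalence.to (T-∧ {geqₜ t λ′ μ}) h
                 λ′≥ν , ν≥μ = Equivalence.to (T-∧ {geqₜ t λ′ ν}) λ′≥ν×ν≥μ
             in Equivalence.from (T-∧ {geqₜ t ν μ}) (ν≥μ , Equivalence.to λ′≥ν⇔hook λ′≥ν)
      from : T (geqₜ t ν μ ∧ addHook t ν λ′) → T (geqₜ t λ′ μ ∧ between λ′ ν)
      from h = let ν≥μ , hook = Equivalence.to (T-∧ {geqₜ t ν μ}) h
               in Equivalence.from (T-∧ {geqₜ t λ′ μ})
                    ( addHook-preserves-geqₜ μ ν λ′ m ν∈ ∣λ′∣ ν≥μ hook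
                    , Equivalence.from (T-∧ {geqₜ t λ′ ν}) (Equivalence.from λ′≥ν⇔hook hook , ν≥μ))

module Telescoping {c ℓ : Level} (R : CommutativeRing c ℓ) (t : ℕ) .{{_ : NonZero t}} (μ : List ℕ) where

  open CommutativeRing R
    using (Carrier; _≈_; sym; setoid; +-commutativeMonoid; +-group)
    renaming (_+_ to _+ᴿ_; _-_ to _-ᴿ_)
  open ListSum +-commutativeMonoid
  open Hooks t
  open import Algebra.Properties.Group +-group using (//-rightDividesˡ)
  open import Relation.Binary.Reasoning.Setoid setoid

  above : List ℕ → Bool
  above λ′ = geqₜ t λ′ μ

  hookSum : (List ℕ → Carrier) → ℕ → Carrier
  hookSum g n = ∑ (filterᴮ above (level μ n)) (λ ν → F t μ ν · ∑ (filterᴮ (addHook t ν) (level μ (suc n))) g)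

  P-suc≈hookSum : ∀ g n → P R t μ g (suc n) ≈ hookSum g n
  P-suc≈hookSum g n = begin
    ∑ (filterᴮ above A) (λ λ′ → F t μ λ′ · g λ′)
      ≈⟨ ∑-cong (filterᴮ above A) (λ λ′∈ → expand-F (proj₁ (∈-filterᴮ⁻ above A λ′∈))) ⟩
    ∑ (filterᴮ above A) (λ λ′ → ∑ (filterᴮ (between μ λ′) B) (λ ν → F t μ ν · g λ′))
      ≈⟨ ∑-filterᴮ-comm above (between μ) above (addHook t) A B (λ λ′ ν → F t μ ν · g λ′)
           (geqₜ-between≡geqₜ-addHook μ n) ⟩
    ∑ (filterᴮ above B) (λ ν → ∑ (filterᴮ (addHook t ν) A) (λ λ′ → F t μ ν · g λ′))
      ≈⟨ ∑-cong (filterᴮ above B) (λ {ν} _ → sym (·-∑ (F t μ ν) (filterᴮ (addHook t ν) A) g)) ⟩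
    hookSum g n ∎
    where
    A B : List (List ℕ)
    A = level μ (suc n)
    B = level μ n
    expand-F : ∀ {λ′} → λ′ ∈ A → F t μ λ′ · g λ′ ≈ ∑ (filterᴮ (between μ λ′) B) (λ ν → F t μ ν · g λ′)
    expand-F {λ′} λ′∈ = begin
      F t μ λ′ · g λ′                                          ≡⟨ cong (_· g λ′) (F-recursion-level μ n λ′∈) ⟩
      sum (map (F t μ) (filterᴮ (between μ λ′) B)) · g λ′     ≈⟨ sum-· (filterᴮ (between μ λ′) B) (F t μ) (g λ′) ⟩
      ∑ (filterᴮ (between μ λ′) B) (λ ν → F t μ ν · g λ′)     ∎

  PD+P≈hookSum : ∀ g n → P R t μ (Dₜ R t g) n +ᴿ P R t μ g n ≈ hookSum g n
  PD+P≈hookSum g n = begin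
    P R t μ (Dₜ R t g) n +ᴿ P R t μ g n
      ≈⟨ ∑-+ (filterᴮ above B) (λ ν → F t μ ν · Dₜ R t g ν) (λ ν → F t μ ν · g ν) ⟨
    ∑ (filterᴮ above B) (λ ν → F t μ ν · Dₜ R t g ν +ᴿ F t μ ν · g ν)
      ≈⟨ ∑-cong (filterᴮ above B) (λ ν∈ → recombine (proj₁ (∈-filterᴮ⁻ above B ν∈))) ⟩
    hookSum g n ∎
    where
    B : List (List ℕ)
    B = level μ n
    recombine : ∀ {ν} → ν ∈ B →
      F t μ ν · Dₜ R t g ν +ᴿ F t μ ν · g ν ≈ F t μ ν · ∑ (filterᴮ (addHook t ν) (level μ (suc n))) g
    recombine {ν} ν∈ = begin
      F t μ ν · (S -ᴿ g ν) +ᴿ F t μ ν · g ν   ≈⟨ ·-distrib-∙ (S -ᴿ g ν) (g ν) (F t μ ν) ⟨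
      F t μ ν · (S -ᴿ g ν +ᴿ g ν)             ≈⟨ ·-congʳ (F t μ ν) (//-rightDividesˡ (g ν) S) ⟩
      F t μ ν · S                              ≡⟨ cong (λ L → F t μ ν · ∑ (filterᴮ (addHook t ν) L) g)
                                                       (partitions-after-hook μ n ν∈) ⟩
      F t μ ν · ∑ (filterᴮ (addHook t ν) (level μ (suc n))) g ∎
      where
      S : Carrier
      S = ∑ (filterᴮ (addHook t ν) (partitions (∣ ν ∣ₚ + t))) g

lemma2p2 : {c ℓ : Level} (R : CommutativeRing c ℓ) (t : ℕ) → 1 ≤ t →
           (μ : List ℕ) → IsPartition μ →
           (g : List ℕ → CommutativeRing.Carrier R) → (n : ℕ) →
           CommutativeRing._≈_ R
             (CommutativeRing._-_ R (P R t μ g (suc n)) (P R t μ g n))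
             (P R t μ (Dₜ R t g) n)
-- The argument works for any list μ.
lemma2p2 R t 1≤t μ _ g n = begin
  P R t μ g (suc n) -ᴿ P R t μ g n                             ≈⟨ +-congʳ (P-suc≈hookSum g n) ⟩
  hookSum g n -ᴿ P R t μ g n                                    ≈⟨ +-congʳ (PD+P≈hookSum g n) ⟨
  (P R t μ (Dₜ R t g) n +ᴿ P R t μ g n) -ᴿ P R t μ g n          ≈⟨ //-rightDividesʳ (P R t μ g n) _ ⟩
  P R t μ (Dₜ R t g) n                                          ∎
  where
  open CommutativeRing R using (+-congʳ; setoid; +-group) renaming (_+_ to _+ᴿ_; _-_ to _-ᴿ_)
  open Telescoping R t {{>-nonZero 1≤t}} μ
  open import Algebra.Properties.Group +-group using (//-rightDividesʳ)
  open import Relation.Binary.Reasoning.Setoid setoid
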